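{- Let $S=\{(1/(1-z),\,z/(1-z))\}$ and let $B$ be the Bell subgroup of the Riordan group (over real coefficients). Then \[ C_B(S)=\left\{\left(\frac{1}{1-rz},\,\frac{z}{1-rz}\right): r\in\mathbb{R}\right\}. \]
   Context: Here $\mathcal{F}=\mathbb{R}[[z]]$ and $\mathcal{F}_r$ is the set of formal power series of order $r$ (least index of a nonzero coefficient equals $r$). A (proper) Riordan array is a pair $(d(z),h(z))$ with $d\in\mathcal{F}_0$, $h\in\mathcal{F}_1$, identified with the infinite lower triangular matrix whose $(n,k)$ entry is $[z^n]d(z)h(z)^k$; the Riordan group is the set of such arrays with product $(d_1,h_1)(d_2,h_2)=(d_1\cdot d_2(h_1),\,h_2(h_1))$ and identity $(1,z)$. The Bell subgroup is $B=\{(d(z),zd(z)): d\in\mathcal{F}_0\}$. For a subset $S$ of a group $H$, $C_H(S)=\{g\in H: gs=sg \text{ for all } s\in S\}$. -}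

module Defs where

open import Data.Nat using (ℕ; zero; suc; _∸_)
open import Data.Product using (Σ; ∃; _×_; _,_)
open import Data.Sum using (_⊎_)
open import Relation.Binary.PropositionalEquality using (_≡_; _≢_)

record RealField : Set₁ where
  infixl 6 _+_
  infixl 7 _*_
  infix 4 _≤_
  field
    Carrier : Set
    0ℝ 1ℝ   : Carrier
    _+_ _*_ : Carrier → Carrier → Carrier
    -_      : Carrier → Carrier
    inv     : (x : Carrier) → x ≢ 0ℝ → Carrier
    _≤_     : Carrier → Carrier → Set
    +-assoc  : ∀ x y z → (x + y) + z ≡ x + (y + z)
    +-comm   : ∀ x y → x + y ≡ y + x
    +-idˡ    : ∀ x → 0ℝ + x ≡ x
    +-invˡ   : ∀ x → (- x) + x ≡ 0ℝ
    *-assoc  : ∀ x y z → (x * y) * z ≡ x * (y * z)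
    *-comm   : ∀ x y → x * y ≡ y * x
    *-idˡ    : ∀ x → 1ℝ * x ≡ x
    *-invˡ   : ∀ x (p : x ≢ 0ℝ) → inv x p * x ≡ 1ℝ
    distribˡ : ∀ x y z → x * (y + z) ≡ x * y + x * z
    1≢0      : 1ℝ ≢ 0ℝ
    ≤-refl    : ∀ x → x ≤ x
    ≤-trans   : ∀ {x y z} → x ≤ y → y ≤ z → x ≤ z
    ≤-antisym : ∀ {x y} → x ≤ y → y ≤ x → x ≡ y
    ≤-total   : ∀ x y → (x ≤ y) ⊎ (y ≤ x)
    +-mono-≤  : ∀ {x y} z → x ≤ y → x + z ≤ y + z
    *-nonneg  : ∀ {x y} → 0ℝ ≤ x → 0ℝ ≤ y → 0ℝ ≤ x * y
    lub : (P : Carrier → Set) → (∃ λ x → P x) →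
          (∃ λ b → ∀ x → P x → x ≤ b) →
          ∃ λ s → (∀ x → P x → x ≤ s) × (∀ b → (∀ x → P x → x ≤ b) → s ≤ b)

module Riordan (ℝ : RealField) where
  open RealField ℝ

  FPS : Set
  FPS = ℕ → Carrier

  _^_ : Carrier → ℕ → Carrier
  x ^ zero  = 1ℝ
  x ^ suc n = x * (x ^ n)

  sumTo : ℕ → (ℕ → Carrier) → Carrier
  sumTo zero    f = f 0
  sumTo (suc n) f = sumTo n f + f (suc n)

  _·_ : FPS → FPS → FPS
  (f · g) n = sumTo n (λ i → f i * g (n ∸ i))

  one : FPS
  one zero    = 1ℝ
  one (suc n) = 0ℝ

  pow : FPS → ℕ → FPS
  pow h zero    = one
  pow h (suc k) = h · pow h k

  -- composition d(h(z)), for h of order ≥ 1:  [z^n] d(h) = Σ_{k≤n} d_k [z^n] h^k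
  _∘ₛ_ : FPS → FPS → FPS
  (d ∘ₛ h) n = sumTo n (λ k → d k * pow h k n)

  zmul : FPS → FPS
  zmul f zero    = 0ℝ
  zmul f (suc n) = f n

  geom : Carrier → FPS
  geom r n = r ^ n

  Order0 : FPS → Set
  Order0 d = d 0 ≢ 0ℝ

  Order1 : FPS → Set
  Order1 h = (h 0 ≡ 0ℝ) × (h 1 ≢ 0ℝ)

  record RiordanArray : Set where
    constructor ⟨_,_⟩[_,_]
    field
      d  : FPS
      h  : FPS
      d∈F₀ : Order0 d
      h∈F₁ : Order1 h
  open RiordanArray public

  Pair : Set
  Pair = FPS × FPS

  pair : RiordanArray → Pair
  pair A = d A , h A

  _⋆_ : Pair → Pair → Pair
  (d₁ , h₁) ⋆ (d₂ , h₂) = (d₁ · (d₂ ∘ₛ h₁)) , (h₂ ∘ₛ h₁)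

  _≈ₚ_ : Pair → Pair → Set
  (d₁ , h₁) ≈ₚ (d₂ , h₂) = (∀ n → d₁ n ≡ d₂ n) × (∀ n → h₁ n ≡ h₂ n)

  InBell : RiordanArray → Set
  InBell A = ∃ λ e → Order0 e × (pair A ≈ₚ (e , zmul e))

  pascal : Pair
  pascal = geom 1ℝ , zmul (geom 1ℝ)

  CommutesWithS : RiordanArray → Set
  CommutesWithS A = (pair A ⋆ pascal) ≈ₚ (pascal ⋆ pair A)

  InCentralizer : RiordanArray → Set
  InCentralizer A = InBell A × CommutesWithS A

  geomPair : Carrier → Pair
  geomPair r = geom r , zmul (geom r)

module Submission where

-- A Bell array (e, z e) is determined by h = z e, and its second component must commute with
-- φ = z/(1-z) under composition: h ∘ φ = φ ∘ h = h/(1-h), so K = h ∘ φ satisfies K = h + h·K.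
-- The coefficients of z² give h₁ = h₁², hence h₁ = 1; those of z^(n+4) express (n+1)·h_(n+3)
-- through h₀,…,h_(n+2), so h is determined by h₂ = r, and characteristic zero makes n+1
-- invertible. Conversely r ↦ (1/(1-rz), z/(1-rz)) is a homomorphism from (ℝ,+) into the Riordan
-- group, so its image is commutative and contains the Pascal array (r = 1); this also provides
-- the solution z/(1-rz) with h₂ = r.

open import Defs
open import Algebra.Bundles using (CommutativeRing)
open import Algebra.Structures using (IsCommutativeRing)
import Algebra.Definitions.RawMonoid as RawMonoidDefinitions
import Algebra.Properties.Ring as RingProperties
import Algebra.Properties.CommutativeSemigroup as CommutativeSemigroupProperties
open import Data.Nat using (ℕ; zero; suc; _∸_; z≤n; s≤s) renaming (_≤_ to _≤ℕ_; _<_ to _<ℕ_)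
import Data.Nat.Properties as ℕ
open import Data.Product using (∃; _×_; _,_; proj₁; proj₂)
open import Data.Sum using (inj₁; inj₂)
open import Level using (0ℓ)
open import Relation.Binary.PropositionalEquality

module PascalCentralizer (ℝ : RealField) where
  open RealField ℝ
  open Riordan ℝ

  +-*-isCommutativeRing : IsCommutativeRing _≡_ _+_ _*_ -_ 0ℝ 1ℝ
  +-*-isCommutativeRing = record
    { isRing = record
      { +-isAbelianGroup = record
        { isGroup = record
          { isMonoid = record
            { isSemigroup = record
              { isMagma = record { isEquivalence = isEquivalence ; ∙-cong = cong₂ _+_ }
              ; assoc = +-assoc }
            ; identity = +-idˡ , λ x → trans (+-comm x 0ℝ) (+-idˡ x) }
          ; inverse = +-invˡ , λ x → trans (+-comm x (- x)) (+-invˡ x)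
          ; ⁻¹-cong = cong -_ }
        ; comm = +-comm }
      ; *-cong = cong₂ _*_
      ; *-assoc = *-assoc
      ; *-identity = *-idˡ , λ x → trans (*-comm x 1ℝ) (*-idˡ x)
      ; distrib = distribˡ , λ x y z → trans (*-comm (y + z) x)
                    (trans (distribˡ x y z) (cong₂ _+_ (*-comm x y) (*-comm x z))) }
    ; *-comm = *-comm }

  commutativeRing : CommutativeRing 0ℓ 0ℓ
  commutativeRing = record { isCommutativeRing = +-*-isCommutativeRing }

  open CommutativeRing commutativeRing
    using (+-identityʳ; *-identityʳ; -‿inverseʳ; distribʳ; zeroˡ; zeroʳ; +-rawMonoid; +-commutativeSemigroup; *-commutativeSemigroup)
  module +CS = CommutativeSemigroupProperties +-commutativeSemigroup
  module *CS = CommutativeSemigroupProperties *-commutativeSemigroup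
  open RingProperties (CommutativeRing.ring commutativeRing)
    using (+-cancelˡ; +-cancelʳ; -‿distribˡ-*; -‿involutive)
  open RawMonoidDefinitions +-rawMonoid using () renaming (_×_ to _×ᵣ_)

  *-cancelʳ-≢0 : ∀ {x y} z → z ≢ 0ℝ → x * z ≡ y * z → x ≡ y
  *-cancelʳ-≢0 {x} {y} z z≢0 xz≡yz = begin
      x                      ≡⟨ sym (*-identityʳ x) ⟩
      x * 1ℝ                 ≡⟨ cong (x *_) (sym z·z⁻¹≡1) ⟩
      x * (z * inv z z≢0)    ≡⟨ sym (*-assoc x z _) ⟩
      (x * z) * inv z z≢0    ≡⟨ cong (_* inv z z≢0) xz≡yz ⟩
      (y * z) * inv z z≢0    ≡⟨ *-assoc y z _ ⟩
      y * (z * inv z z≢0)    ≡⟨ cong (y *_) z·z⁻¹≡1 ⟩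
      y * 1ℝ                 ≡⟨ *-identityʳ y ⟩
      y                      ∎
    where
      open ≡-Reasoning
      z·z⁻¹≡1 : z * inv z z≢0 ≡ 1ℝ
      z·z⁻¹≡1 = trans (*-comm z _) (*-invˡ z z≢0)

  0≤1 : 0ℝ ≤ 1ℝ
  0≤1 with ≤-total 0ℝ 1ℝ
  ... | inj₁ 0≤1′ = 0≤1′
  ... | inj₂ 1≤0 = subst (0ℝ ≤_) [-1]²≡1 (*-nonneg 0≤-1 0≤-1)
    where
      0≤-1 : 0ℝ ≤ - 1ℝ
      0≤-1 = subst₂ _≤_ (-‿inverseʳ 1ℝ) (+-idˡ (- 1ℝ)) (+-mono-≤ (- 1ℝ) 1≤0)
      [-1]²≡1 : - 1ℝ * - 1ℝ ≡ 1ℝ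
      [-1]²≡1 = begin
          - 1ℝ * - 1ℝ      ≡⟨ sym (-‿distribˡ-* 1ℝ (- 1ℝ)) ⟩
          - (1ℝ * - 1ℝ)    ≡⟨ cong -_ (*-idˡ (- 1ℝ)) ⟩
          - (- 1ℝ)         ≡⟨ -‿involutive 1ℝ ⟩
          1ℝ               ∎
        where open ≡-Reasoning

  0≤×1 : ∀ n → 0ℝ ≤ n ×ᵣ 1ℝ
  0≤×1 zero    = ≤-refl 0ℝ
  0≤×1 (suc n) = ≤-trans (0≤×1 n)
    (subst (_≤ suc n ×ᵣ 1ℝ) (+-idˡ (n ×ᵣ 1ℝ)) (+-mono-≤ (n ×ᵣ 1ℝ) 0≤1))

  suc×1≢0 : ∀ n → suc n ×ᵣ 1ℝ ≢ 0ℝ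
  suc×1≢0 n 1+n≡0 = 1≢0 (≤-antisym 1≤0 0≤1)
    where
      1≤0 : 1ℝ ≤ 0ℝ
      1≤0 = subst₂ _≤_ (+-idˡ 1ℝ) (trans (+-comm (n ×ᵣ 1ℝ) 1ℝ) 1+n≡0) (+-mono-≤ 1ℝ (0≤×1 n))

  sumTo-cong : ∀ n {f g : ℕ → Carrier} → (∀ i → i ≤ℕ n → f i ≡ g i) → sumTo n f ≡ sumTo n g
  sumTo-cong zero    f≡g = f≡g 0 z≤n
  sumTo-cong (suc n) f≡g =
    cong₂ _+_ (sumTo-cong n (λ i i≤n → f≡g i (ℕ.m≤n⇒m≤1+n i≤n))) (f≡g (suc n) ℕ.≤-refl)

  sumTo-zero : ∀ n {f : ℕ → Carrier} → (∀ i → i ≤ℕ n → f i ≡ 0ℝ) → sumTo n f ≡ 0ℝ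
  sumTo-zero zero    f≡0 = f≡0 0 z≤n
  sumTo-zero (suc n) f≡0 = trans
    (cong₂ _+_ (sumTo-zero n (λ i i≤n → f≡0 i (ℕ.m≤n⇒m≤1+n i≤n))) (f≡0 (suc n) ℕ.≤-refl))
    (+-idˡ 0ℝ)

  sumTo-head : ∀ n (f : ℕ → Carrier) → sumTo (suc n) f ≡ f 0 + sumTo n (λ i → f (suc i))
  sumTo-head zero    f = refl
  sumTo-head (suc n) f = trans (cong (_+ f (suc (suc n))) (sumTo-head n f)) (+-assoc _ _ _)

  sumTo-+ : ∀ n (f g : ℕ → Carrier) → sumTo n (λ i → f i + g i) ≡ sumTo n f + sumTo n g
  sumTo-+ zero    f g = refl
  sumTo-+ (suc n) f g = trans (cong (_+ (f (suc n) + g (suc n))) (sumTo-+ n f g)) (+CS.interchange _ _ _ _)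

  sumTo-*ˡ : ∀ n c (f : ℕ → Carrier) → sumTo n (λ i → c * f i) ≡ c * sumTo n f
  sumTo-*ˡ zero    c f = refl
  sumTo-*ˡ (suc n) c f = trans (cong (_+ c * f (suc n)) (sumTo-*ˡ n c f)) (sym (distribˡ c _ _))

  sumTo-swap : ∀ m n (f : ℕ → ℕ → Carrier) →
    sumTo m (λ i → sumTo n (f i)) ≡ sumTo n (λ k → sumTo m (λ i → f i k))
  sumTo-swap zero    n f = refl
  sumTo-swap (suc m) n f = trans (cong (_+ sumTo n (f (suc m))) (sumTo-swap m n f))
    (sym (sumTo-+ n (λ k → sumTo m (λ i → f i k)) (f (suc m))))

  sumTo-pad : ∀ {m n} (f : ℕ → Carrier) → m ≤ℕ n → (∀ k → m <ℕ k → k ≤ℕ n → f k ≡ 0ℝ) →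
    sumTo m f ≡ sumTo n f
  sumTo-pad {n = zero}  f z≤n       f≡0 = refl
  sumTo-pad {m} {suc n} f m≤1+n f≡0 with ℕ.m≤n⇒m<n∨m≡n m≤1+n
  ... | inj₂ refl          = refl
  ... | inj₁ (s≤s m≤n) = begin
      sumTo m f               ≡⟨ sumTo-pad f m≤n (λ k m<k k≤n → f≡0 k m<k (ℕ.m≤n⇒m≤1+n k≤n)) ⟩
      sumTo n f               ≡⟨ sym (+-identityʳ _) ⟩
      sumTo n f + 0ℝ          ≡⟨ cong (sumTo n f +_) (sym (f≡0 (suc n) (s≤s m≤n) ℕ.≤-refl)) ⟩
      sumTo (suc n) f         ∎
    where open ≡-Reasoning

  sumTo-shift : ∀ n (f : ℕ → Carrier) → f 0 ≡ 0ℝ → f (suc n) ≡ 0ℝ →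
    sumTo n (λ i → f (suc i)) ≡ sumTo n f
  sumTo-shift n f f0≡0 f[1+n]≡0 = begin
      sumTo n (λ i → f (suc i))         ≡⟨ sym (+-idˡ _) ⟩
      0ℝ + sumTo n (λ i → f (suc i))    ≡⟨ cong (_+ sumTo n (λ i → f (suc i))) (sym f0≡0) ⟩
      f 0 + sumTo n (λ i → f (suc i))   ≡⟨ sym (sumTo-head n f) ⟩
      sumTo n f + f (suc n)             ≡⟨ cong (sumTo n f +_) f[1+n]≡0 ⟩
      sumTo n f + 0ℝ                    ≡⟨ +-identityʳ _ ⟩
      sumTo n f                         ∎
    where open ≡-Reasoning

  ·-cong : ∀ {a a′ b b′} → a ≗ a′ → b ≗ b′ → a · b ≗ a′ · b′
  ·-cong a≗a′ b≗b′ n = sumTo-cong n (λ i _ → cong₂ _*_ (a≗a′ i) (b≗b′ (n ∸ i)))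

  pow-cong : ∀ {h h′} → h ≗ h′ → ∀ k → pow h k ≗ pow h′ k
  pow-cong h≗h′ zero    n = refl
  pow-cong h≗h′ (suc k) = ·-cong h≗h′ (pow-cong h≗h′ k)

  ∘ₛ-cong : ∀ {c c′ h h′} → c ≗ c′ → h ≗ h′ → c ∘ₛ h ≗ c′ ∘ₛ h′
  ∘ₛ-cong c≗c′ h≗h′ n = sumTo-cong n (λ k _ → cong₂ _*_ (c≗c′ k) (pow-cong h≗h′ k n))

  ∘ₛ-local : ∀ {c c′} h n → (∀ k → k ≤ℕ n → c k ≡ c′ k) → (c ∘ₛ h) n ≡ (c′ ∘ₛ h) n
  ∘ₛ-local h n c≡c′ = sumTo-cong n (λ k k≤n → cong (_* pow h k n) (c≡c′ k k≤n))

  ⋆-cong : ∀ {p p′ q q′} → p ≈ₚ p′ → q ≈ₚ q′ → (p ⋆ q) ≈ₚ (p′ ⋆ q′)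
  ⋆-cong (d≗d′ , h≗h′) (e≗e′ , k≗k′) = ·-cong d≗d′ (∘ₛ-cong e≗e′ h≗h′) , ∘ₛ-cong k≗k′ h≗h′

  ≈ₚ-sym : ∀ {p q} → p ≈ₚ q → q ≈ₚ p
  ≈ₚ-sym (d≗d′ , h≗h′) = (λ n → sym (d≗d′ n)) , (λ n → sym (h≗h′ n))

  ≈ₚ-trans : ∀ {p q s} → p ≈ₚ q → q ≈ₚ s → p ≈ₚ s
  ≈ₚ-trans (d≗d′ , h≗h′) (d′≗d″ , h′≗h″) = (λ n → trans (d≗d′ n) (d′≗d″ n)) , (λ n → trans (h≗h′ n) (h′≗h″ n))

  zmul-cong : ∀ {a b} → a ≗ b → zmul a ≗ zmul b
  zmul-cong a≗b zero    = refl
  zmul-cong a≗b (suc n) = a≗b n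

  ·-oneʳ : ∀ a → a · one ≗ a
  ·-oneʳ a zero    = *-identityʳ (a 0)
  ·-oneʳ a (suc n) = begin
      sumTo n (λ i → a i * one (suc n ∸ i)) + a (suc n) * one (suc n ∸ suc n)
        ≡⟨ cong₂ _+_ (sumTo-zero n (λ i i≤n → trans (cong (λ j → a i * one j) (ℕ.+-∸-assoc 1 i≤n)) (zeroʳ (a i))))
                     (cong (λ j → a (suc n) * one j) (ℕ.n∸n≡0 n)) ⟩
      0ℝ + a (suc n) * 1ℝ  ≡⟨ +-idˡ _ ⟩
      a (suc n) * 1ℝ       ≡⟨ *-identityʳ _ ⟩
      a (suc n)            ∎
    where open ≡-Reasoning

  ·-distribˡ-+ : ∀ a b c n → (a · (λ j → b j + c j)) n ≡ (a · b) n + (a · c) n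
  ·-distribˡ-+ a b c n = trans (sumTo-cong n (λ i _ → distribˡ (a i) _ _)) (sumTo-+ n _ _)

  zmul-·ˡ : ∀ a b → zmul a · b ≗ zmul (a · b)
  zmul-·ˡ a b zero    = zeroˡ (b 0)
  zmul-·ˡ a b (suc n) = trans (sumTo-head n _) (trans (cong (_+ (a · b) n) (zeroˡ _)) (+-idˡ _))

  geom-·-suc : ∀ r b n → (geom r · b) (suc n) ≡ b (suc n) + r * (geom r · b) n
  geom-·-suc r b n = trans (sumTo-head n _) (cong₂ _+_ (*-idˡ _)
    (trans (sumTo-cong n (λ i _ → *-assoc r (r ^ i) (b (n ∸ i)))) (sumTo-*ˡ n r _)))

  pow-vanishes : ∀ {h} → h 0 ≡ 0ℝ → ∀ k n → n <ℕ k → pow h k n ≡ 0ℝ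
  pow-vanishes {h} h0≡0 (suc k) n (s≤s n≤k) = sumTo-zero n term≡0
    where
      term≡0 : ∀ i → i ≤ℕ n → h i * pow h k (n ∸ i) ≡ 0ℝ
      term≡0 zero    _    = trans (cong (_* pow h k n) h0≡0) (zeroˡ _)
      term≡0 (suc i) i<n = trans (cong (h (suc i) *_)
        (pow-vanishes h0≡0 k (n ∸ suc i) (ℕ.<-≤-trans (ℕ.∸-monoʳ-< (s≤s z≤n) i<n) n≤k))) (zeroʳ _)

  ∘ₛ-zmul : ∀ {h} → h 0 ≡ 0ℝ → ∀ c → zmul c ∘ₛ h ≗ h · (c ∘ₛ h)
  ∘ₛ-zmul {h} h0≡0 c n = sym (begin
      sumTo n (λ i → h i * sumTo (n ∸ i) (λ k → c k * pow h k (n ∸ i)))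
        ≡⟨ sumTo-cong n (λ i _ → cong (h i *_) (sumTo-pad _ (ℕ.m∸n≤m n i)
             (λ k n-i<k _ → trans (cong (c k *_) (pow-vanishes h0≡0 k (n ∸ i) n-i<k)) (zeroʳ _)))) ⟩
      sumTo n (λ i → h i * sumTo n (λ k → c k * pow h k (n ∸ i)))
        ≡⟨ sumTo-cong n (λ i _ → sym (sumTo-*ˡ n (h i) _)) ⟩
      sumTo n (λ i → sumTo n (λ k → h i * (c k * pow h k (n ∸ i))))
        ≡⟨ sumTo-swap n n _ ⟩
      sumTo n (λ k → sumTo n (λ i → h i * (c k * pow h k (n ∸ i))))
        ≡⟨ sumTo-cong n (λ k _ → trans (sumTo-cong n (λ i _ → *CS.x∙yz≈y∙xz (h i) (c k) _)) (sumTo-*ˡ n (c k) _)) ⟩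
      sumTo n (λ k → c k * pow h (suc k) n)
        ≡⟨ sumTo-shift n (λ k → zmul c k * pow h k n) (zeroˡ _)
             (trans (cong (c n *_) (pow-vanishes h0≡0 (suc n) n ℕ.≤-refl)) (zeroʳ _)) ⟩
      (zmul c ∘ₛ h) n ∎)
    where open ≡-Reasoning

  one-∘ₛ : ∀ h → one ∘ₛ h ≗ one
  one-∘ₛ h zero    = *-idˡ 1ℝ
  one-∘ₛ h (suc n) = begin
      sumTo (suc n) (λ k → one k * pow h k (suc n))
        ≡⟨ sumTo-head n _ ⟩
      1ℝ * 0ℝ + sumTo n (λ k → 0ℝ * pow h (suc k) (suc n))
        ≡⟨ cong₂ _+_ (zeroʳ 1ℝ) (sumTo-zero n (λ k _ → zeroˡ _)) ⟩
      0ℝ + 0ℝ ≡⟨ +-idˡ 0ℝ ⟩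
      0ℝ ∎
    where open ≡-Reasoning

  ∘ₛ-linear : ∀ u a v h n → ((λ k → u k + a * v k) ∘ₛ h) n ≡ (u ∘ₛ h) n + a * (v ∘ₛ h) n
  ∘ₛ-linear u a v h n = begin
      sumTo n (λ k → (u k + a * v k) * pow h k n)
        ≡⟨ sumTo-cong n (λ k _ → trans (distribʳ _ (u k) _) (cong (u k * pow h k n +_) (*-assoc a (v k) _))) ⟩
      sumTo n (λ k → u k * pow h k n + a * (v k * pow h k n))
        ≡⟨ sumTo-+ n _ _ ⟩
      (u ∘ₛ h) n + sumTo n (λ k → a * (v k * pow h k n))
        ≡⟨ cong ((u ∘ₛ h) n +_) (sumTo-*ˡ n a _) ⟩
      (u ∘ₛ h) n + a * (v ∘ₛ h) n ∎
    where open ≡-Reasoning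

  -- Geometric series and the arrays (1/(1-rz), z/(1-rz))

  geom-unfold : ∀ a k → geom a k ≡ one k + a * zmul (geom a) k
  geom-unfold a zero    = trans (sym (+-identityʳ 1ℝ)) (cong (1ℝ +_) (sym (zeroʳ a)))
  geom-unfold a (suc k) = sym (+-idˡ (a * a ^ k))

  geom-∘ₛ : ∀ {h} → h 0 ≡ 0ℝ → ∀ a n → (geom a ∘ₛ h) n ≡ one n + a * (h · (geom a ∘ₛ h)) n
  geom-∘ₛ {h} h0≡0 a n = begin
      (geom a ∘ₛ h) n
        ≡⟨ ∘ₛ-local h n (λ k _ → geom-unfold a k) ⟩
      ((λ k → one k + a * zmul (geom a) k) ∘ₛ h) n
        ≡⟨ ∘ₛ-linear one a (zmul (geom a)) h n ⟩
      (one ∘ₛ h) n + a * (zmul (geom a) ∘ₛ h) n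
        ≡⟨ cong₂ (λ u v → u + a * v) (one-∘ₛ h n) (∘ₛ-zmul h0≡0 (geom a) n) ⟩
      one n + a * (h · (geom a ∘ₛ h)) n ∎
    where open ≡-Reasoning

  geom-unique : ∀ {u} c → u 0 ≡ 1ℝ → (∀ n → u (suc n) ≡ c * u n) → u ≗ geom c
  geom-unique c u0≡1 u-rec zero    = u0≡1
  geom-unique c u0≡1 u-rec (suc n) = trans (u-rec n) (cong (c *_) (geom-unique c u0≡1 u-rec n))

  -- With H = z/(1-bz) and Y = (1/(1-az)) ∘ H one has Y = 1 + a·H·Y, so U = Y/(1-bz) satisfies
  -- U₀ = 1 and U_(n+1) = (a+b)·U_n.
  module _ (a b : Carrier) where
    private
      H Y U : FPS
      H = zmul (geom b)
      Y = geom a ∘ₛ H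
      U = geom b · Y

      H·Y≗zmulU : H · Y ≗ zmul U
      H·Y≗zmulU = zmul-·ˡ (geom b) Y

      Y-suc : ∀ n → Y (suc n) ≡ a * U n
      Y-suc n = trans (geom-∘ₛ {H} refl a (suc n)) (trans (cong (λ t → 0ℝ + a * t) (H·Y≗zmulU (suc n))) (+-idˡ _))

      U≗geom : U ≗ geom (a + b)
      U≗geom = geom-unique (a + b) U0≡1 U-suc
        where
          U0≡1 : U 0 ≡ 1ℝ
          U0≡1 = begin
              1ℝ * Y 0                   ≡⟨ *-idˡ (Y 0) ⟩
              Y 0                        ≡⟨ geom-∘ₛ {H} refl a 0 ⟩
              1ℝ + a * (H · Y) 0         ≡⟨ cong (λ t → 1ℝ + a * t) (H·Y≗zmulU 0) ⟩
              1ℝ + a * 0ℝ                ≡⟨ cong (1ℝ +_) (zeroʳ a) ⟩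
              1ℝ + 0ℝ                    ≡⟨ +-identityʳ 1ℝ ⟩
              1ℝ                         ∎
            where open ≡-Reasoning
          U-suc : ∀ n → U (suc n) ≡ (a + b) * U n
          U-suc n = begin
              U (suc n)                  ≡⟨ geom-·-suc b Y n ⟩
              Y (suc n) + b * U n        ≡⟨ cong (_+ b * U n) (Y-suc n) ⟩
              a * U n + b * U n          ≡⟨ sym (distribʳ (U n) a b) ⟩
              (a + b) * U n              ∎
            where open ≡-Reasoning

    geomPair-⋆ : (geomPair b ⋆ geomPair a) ≈ₚ geomPair (a + b)
    geomPair-⋆ = U≗geom , λ n → begin
        (zmul (geom a) ∘ₛ H) n   ≡⟨ ∘ₛ-zmul {H} refl (geom a) n ⟩
        (H · Y) n                ≡⟨ H·Y≗zmulU n ⟩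
        zmul U n                 ≡⟨ zmul-cong U≗geom n ⟩
        zmul (geom (a + b)) n    ∎
      where open ≡-Reasoning

  -- Series commuting with z/(1-z)

  pow-zmul-geom-suc : ∀ ρ k n → let P = pow (zmul (geom ρ)) in P (suc k) (suc n) ≡ P k n + ρ * P (suc k) n
  pow-zmul-geom-suc ρ k zero    = begin
      P (suc k) 1                      ≡⟨ zmul-·ˡ (geom ρ) (P k) 1 ⟩
      (geom ρ · P k) 0                 ≡⟨ *-idˡ (P k 0) ⟩
      P k 0                            ≡⟨ sym (+-identityʳ _) ⟩
      P k 0 + 0ℝ                       ≡⟨ cong (P k 0 +_) (sym (zeroʳ ρ)) ⟩
      P k 0 + ρ * 0ℝ                   ≡⟨ cong (λ t → P k 0 + ρ * t) (sym (zmul-·ˡ (geom ρ) (P k) 0)) ⟩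
      P k 0 + ρ * P (suc k) 0          ∎
    where
      open ≡-Reasoning
      P = pow (zmul (geom ρ))
  pow-zmul-geom-suc ρ k (suc n) = trans (zmul-·ˡ (geom ρ) (P k) (suc (suc n)))
    (trans (geom-·-suc ρ (P k) n) (cong (λ t → P k (suc n) + ρ * t) (sym (zmul-·ˡ (geom ρ) (P k) (suc n)))))
    where P = pow (zmul (geom ρ))

  φ : FPS
  φ = zmul (geom 1ℝ)

  pow-φ-diag : ∀ n → pow φ n n ≡ 1ℝ
  pow-φ-diag zero    = refl
  pow-φ-diag (suc n) = begin
      pow φ (suc n) (suc n)              ≡⟨ pow-zmul-geom-suc 1ℝ n n ⟩
      pow φ n n + 1ℝ * pow φ (suc n) n   ≡⟨ cong₂ _+_ (pow-φ-diag n) (trans (*-idˡ _) (pow-vanishes refl (suc n) n ℕ.≤-refl)) ⟩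
      1ℝ + 0ℝ                            ≡⟨ +-identityʳ 1ℝ ⟩
      1ℝ                                 ∎
    where open ≡-Reasoning

  pow-φ-subdiag : ∀ n → pow φ n (suc n) ≡ n ×ᵣ 1ℝ
  pow-φ-subdiag zero    = refl
  pow-φ-subdiag (suc n) = begin
      pow φ (suc n) (suc (suc n))                    ≡⟨ pow-zmul-geom-suc 1ℝ n (suc n) ⟩
      pow φ n (suc n) + 1ℝ * pow φ (suc n) (suc n)   ≡⟨ cong₂ _+_ (pow-φ-subdiag n) (trans (*-idˡ _) (pow-φ-diag (suc n))) ⟩
      n ×ᵣ 1ℝ + 1ℝ                                   ≡⟨ +-comm _ 1ℝ ⟩
      suc n ×ᵣ 1ℝ                                    ∎
    where open ≡-Reasoning

  CommutesWithφ : FPS → Set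
  CommutesWithφ x = φ ∘ₛ x ≗ x ∘ₛ φ

  φ-∘ₛ-equation : ∀ {x} → x 0 ≡ 0ℝ → ∀ n → (φ ∘ₛ x) n ≡ x n + (x · (φ ∘ₛ x)) n
  φ-∘ₛ-equation {x} x0≡0 n = begin
      (φ ∘ₛ x) n                                   ≡⟨ ∘ₛ-zmul x0≡0 (geom 1ℝ) n ⟩
      (x · (geom 1ℝ ∘ₛ x)) n                       ≡⟨ ·-cong {x} (λ _ → refl) unfold n ⟩
      (x · (λ j → one j + (φ ∘ₛ x) j)) n           ≡⟨ ·-distribˡ-+ x one (φ ∘ₛ x) n ⟩
      (x · one) n + (x · (φ ∘ₛ x)) n               ≡⟨ cong (_+ (x · (φ ∘ₛ x)) n) (·-oneʳ x n) ⟩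
      x n + (x · (φ ∘ₛ x)) n                       ∎
    where
      open ≡-Reasoning
      unfold : geom 1ℝ ∘ₛ x ≗ λ j → one j + (φ ∘ₛ x) j
      unfold j = trans (geom-∘ₛ x0≡0 1ℝ j)
        (cong (one j +_) (trans (*-idˡ _) (sym (∘ₛ-zmul x0≡0 (geom 1ℝ) j))))

  ∘ₛφ-equation : ∀ {x} → x 0 ≡ 0ℝ → CommutesWithφ x → ∀ n → (x ∘ₛ φ) n ≡ x n + (x · (x ∘ₛ φ)) n
  ∘ₛφ-equation {x} x0≡0 comm n = begin
      (x ∘ₛ φ) n                   ≡⟨ sym (comm n) ⟩
      (φ ∘ₛ x) n                   ≡⟨ φ-∘ₛ-equation x0≡0 n ⟩
      x n + (x · (φ ∘ₛ x)) n       ≡⟨ cong (x n +_) (·-cong {x} (λ _ → refl) comm n) ⟩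
      x n + (x · (x ∘ₛ φ)) n       ∎
    where open ≡-Reasoning

  ∘ₛφ-0 : ∀ {x} → x 0 ≡ 0ℝ → (x ∘ₛ φ) 0 ≡ 0ℝ
  ∘ₛφ-0 x0≡0 = trans (cong (_* 1ℝ) x0≡0) (zeroˡ 1ℝ)

  ∘ₛφ-1 : ∀ {x} → x 0 ≡ 0ℝ → (x ∘ₛ φ) 1 ≡ x 1
  ∘ₛφ-1 {x} x0≡0 = begin
      x 0 * 0ℝ + x 1 * pow φ 1 1   ≡⟨ cong₂ _+_ (zeroʳ (x 0)) (cong (x 1 *_) (pow-φ-diag 1)) ⟩
      0ℝ + x 1 * 1ℝ                ≡⟨ +-idˡ _ ⟩
      x 1 * 1ℝ                     ≡⟨ *-identityʳ (x 1) ⟩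
      x 1                          ∎
    where open ≡-Reasoning

  commutesWithφ⇒coeff₁≡1 : ∀ {x} → x 0 ≡ 0ℝ → x 1 ≢ 0ℝ → CommutesWithφ x → x 1 ≡ 1ℝ
  commutesWithφ⇒coeff₁≡1 {x} x0≡0 x1≢0 comm =
    sym (*-cancelʳ-≢0 (x 1) x1≢0 (trans (*-idˡ (x 1)) (+-cancelʳ (x 2) _ _ x₁+x₂≡x₁²+x₂)))
    where
      open ≡-Reasoning
      K = x ∘ₛ φ
      x₁+x₂≡x₁²+x₂ : x 1 + x 2 ≡ x 1 * x 1 + x 2
      x₁+x₂≡x₁²+x₂ = begin
          x 1 + x 2
            ≡⟨ cong₂ _+_ (sym (+-idˡ (x 1))) (sym (*-identityʳ (x 2))) ⟩
          (0ℝ + x 1) + x 2 * 1ℝ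
            ≡⟨ cong₂ (λ u v → (u + x 1) + x 2 * v) (sym (zeroʳ (x 0))) (sym (pow-φ-diag 2)) ⟩
          (x 0 * 0ℝ + x 1) + x 2 * pow φ 2 2
            ≡⟨ cong (λ v → (x 0 * 0ℝ + v) + x 2 * pow φ 2 2)
                 (trans (sym (*-identityʳ (x 1))) (cong (x 1 *_) (sym (trans (pow-φ-subdiag 1) (+-identityʳ 1ℝ))))) ⟩
          K 2
            ≡⟨ ∘ₛφ-equation x0≡0 comm 2 ⟩
          x 2 + ((x 0 * K 2 + x 1 * K 1) + x 2 * K 0)
            ≡⟨ cong₂ (λ u v → x 2 + ((u + x 1 * v) + x 2 * K 0))
                 (trans (cong (_* K 2) x0≡0) (zeroˡ (K 2))) (∘ₛφ-1 {x} x0≡0) ⟩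
          x 2 + ((0ℝ + x 1 * x 1) + x 2 * K 0)
            ≡⟨ cong₂ (λ u v → x 2 + (u + x 2 * v)) (+-idˡ _) (∘ₛφ-0 {x} x0≡0) ⟩
          x 2 + (x 1 * x 1 + x 2 * 0ℝ)
            ≡⟨ cong (λ u → x 2 + (x 1 * x 1 + u)) (zeroʳ (x 2)) ⟩
          x 2 + (x 1 * x 1 + 0ℝ)
            ≡⟨ cong (x 2 +_) (+-identityʳ _) ⟩
          x 2 + x 1 * x 1
            ≡⟨ +-comm (x 2) _ ⟩
          x 1 * x 1 + x 2 ∎

  -- For x₀ = 0 and x₁ = 1, the coefficient of z^(n+4) in x ∘ φ = x + x·(x ∘ φ) reads
  --   compLow x n + (n+3)·x_(n+3) + x_(n+4) = x_(n+4) + convLow x n + 2·x_(n+3),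
  -- where compLow and convLow only involve x₀,…,x_(n+2).
  compLow convLow : FPS → ℕ → Carrier
  compLow x n = sumTo (suc (suc n)) (λ k → x k * pow φ k (suc (suc (suc (suc n)))))
  convLow x n = sumTo (suc (suc n)) (λ k → x k * pow φ k (suc (suc (suc n))))
              + sumTo n (λ i → x (suc (suc i)) * (x ∘ₛ φ) (suc (suc n) ∸ i))

  commutesWithφ⇒recurrence : ∀ {x} → x 0 ≡ 0ℝ → x 1 ≡ 1ℝ → CommutesWithφ x →
    ∀ n → compLow x n + x (suc (suc (suc n))) * (suc n ×ᵣ 1ℝ) ≡ convLow x n
  commutesWithφ⇒recurrence {x} x0≡0 x1≡1 comm n = cancel-top (begin
      (compLow x n + x₃ * (1ℝ + (1ℝ + c))) + x₄     ≡⟨ sym ∘ₛφ-top ⟩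
      K (suc (suc (suc (suc n))))                    ≡⟨ ∘ₛφ-equation x0≡0 comm _ ⟩
      x₄ + (x · K) (suc (suc (suc (suc n))))         ≡⟨ cong (x₄ +_) conv-top ⟩
      x₄ + ((convLow x n + x₃) + x₃)                 ∎)
    where
      open ≡-Reasoning
      K  = x ∘ₛ φ
      c  = suc n ×ᵣ 1ℝ
      x₃ = x (suc (suc (suc n)))
      x₄ = x (suc (suc (suc (suc n))))
      S′ = sumTo (suc (suc n)) (λ k → x k * pow φ k (suc (suc (suc n))))
      K₄ = K (suc (suc (suc (suc n))))
      M  = sumTo n (λ i → x (suc (suc i)) * K (suc (suc n) ∸ i))

      ∘ₛφ-top : K (suc (suc (suc (suc n)))) ≡ (compLow x n + x₃ * (1ℝ + (1ℝ + c))) + x₄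
      ∘ₛφ-top = cong₂ (λ u v → (compLow x n + x₃ * u) + v) (pow-φ-subdiag (suc (suc (suc n))))
        (trans (cong (x₄ *_) (pow-φ-diag (suc (suc (suc (suc n)))))) (*-identityʳ x₄))

      conv-top : (x · K) (suc (suc (suc (suc n)))) ≡ (convLow x n + x₃) + x₃
      conv-top = begin
          (x · K) (suc (suc (suc (suc n))))
            ≡⟨ cong (λ u → (u + x₃ * K (suc (suc (suc (suc n))) ∸ suc (suc (suc n))))
                           + x₄ * K (suc (suc (suc (suc n))) ∸ suc (suc (suc (suc n)))))
                 (trans (sumTo-head (suc n) _) (cong (x 0 * K₄ +_) (sumTo-head n _))) ⟩
          ((x 0 * K₄ + (x 1 * K (suc (suc (suc n))) + M)) + x₃ * K (suc n ∸ n)) + x₄ * K (n ∸ n)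
            ≡⟨ cong₂ (λ u v → ((x 0 * K₄ + (x 1 * K (suc (suc (suc n))) + M)) + x₃ * K u) + x₄ * K v)
                 (ℕ.m+n∸n≡m 1 n) (ℕ.n∸n≡0 n) ⟩
          ((x 0 * K₄ + (x 1 * K (suc (suc (suc n))) + M)) + x₃ * K 1) + x₄ * K 0
            ≡⟨ cong₂ (λ u v → ((u + (x 1 * K (suc (suc (suc n))) + M)) + x₃ * v) + x₄ * K 0)
                 (trans (cong (_* K₄) x0≡0) (zeroˡ _)) (trans (∘ₛφ-1 {x} x0≡0) x1≡1) ⟩
          ((0ℝ + (x 1 * K (suc (suc (suc n))) + M)) + x₃ * 1ℝ) + x₄ * K 0
            ≡⟨ cong₂ (λ u v → ((0ℝ + (u * K (suc (suc (suc n))) + M)) + x₃ * 1ℝ) + x₄ * v) x1≡1 (∘ₛφ-0 {x} x0≡0) ⟩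
          ((0ℝ + (1ℝ * K (suc (suc (suc n))) + M)) + x₃ * 1ℝ) + x₄ * 0ℝ
            ≡⟨ cong₂ _+_ (cong₂ _+_ (+-idˡ _) (*-identityʳ x₃)) (zeroʳ x₄) ⟩
          ((1ℝ * K (suc (suc (suc n))) + M) + x₃) + 0ℝ
            ≡⟨ +-identityʳ _ ⟩
          (1ℝ * (S′ + x₃ * pow φ (suc (suc (suc n))) (suc (suc (suc n)))) + M) + x₃
            ≡⟨ cong (λ u → (u + M) + x₃) (trans (*-idˡ _)
                 (cong (S′ +_) (trans (cong (x₃ *_) (pow-φ-diag (suc (suc (suc n))))) (*-identityʳ x₃)))) ⟩
          ((S′ + x₃) + M) + x₃
            ≡⟨ cong (_+ x₃) (+CS.xy∙z≈xz∙y S′ x₃ M) ⟩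
          ((S′ + M) + x₃) + x₃ ∎

      cancel-top : ∀ {A B u v} → (A + u * (1ℝ + (1ℝ + c))) + v ≡ v + ((B + u) + u) → A + u * c ≡ B
      cancel-top {A} {B} {u} {v} eq = +-cancelʳ (u + u) _ _ (+-cancelʳ v _ _ (begin
          ((A + u * c) + (u + u)) + v   ≡⟨ cong (_+ v) (+-assoc A (u * c) (u + u)) ⟩
          (A + ((u * c) + (u + u))) + v ≡⟨ cong (λ t → (A + t) + v) (+-comm (u * c) (u + u)) ⟩
          (A + ((u + u) + u * c)) + v   ≡⟨ cong (λ t → (A + t) + v) (+-assoc u u (u * c)) ⟩
          (A + (u + (u + u * c))) + v   ≡⟨ cong (λ t → (A + t) + v) (sym u[2+c]) ⟩
          (A + u * (1ℝ + (1ℝ + c))) + v ≡⟨ eq ⟩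
          v + ((B + u) + u)             ≡⟨ +-comm v _ ⟩
          ((B + u) + u) + v             ≡⟨ cong (_+ v) (+-assoc B u u) ⟩
          (B + (u + u)) + v             ∎))
        where
          u[2+c] : u * (1ℝ + (1ℝ + c)) ≡ u + (u + u * c)
          u[2+c] = begin
              u * (1ℝ + (1ℝ + c))           ≡⟨ distribˡ u 1ℝ _ ⟩
              u * 1ℝ + u * (1ℝ + c)         ≡⟨ cong (u * 1ℝ +_) (distribˡ u 1ℝ c) ⟩
              u * 1ℝ + (u * 1ℝ + u * c)     ≡⟨ cong₂ (λ s t → s + (t + u * c)) (*-identityʳ u) (*-identityʳ u) ⟩
              u + (u + u * c)               ∎

  AgreeUpTo : ℕ → FPS → FPS → Set
  AgreeUpTo m x y = ∀ j → j ≤ℕ m → x j ≡ y j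

  compLow-local : ∀ {x y} n → AgreeUpTo (suc (suc n)) x y → compLow x n ≡ compLow y n
  compLow-local n x≡y = sumTo-cong (suc (suc n)) (λ k k≤ → cong (_* _) (x≡y k k≤))

  convLow-local : ∀ {x y} n → AgreeUpTo (suc (suc n)) x y → convLow x n ≡ convLow y n
  convLow-local {x} {y} n x≡y = cong₂ _+_
    (sumTo-cong (suc (suc n)) (λ k k≤ → cong (_* _) (x≡y k k≤)))
    (sumTo-cong n (λ i i≤n → cong₂ _*_ (x≡y (suc (suc i)) (s≤s (s≤s i≤n)))
      (∘ₛ-local φ (suc (suc n) ∸ i) (λ k k≤ → x≡y k (ℕ.≤-trans k≤ (ℕ.m∸n≤m _ i))))))

  commutesWithφ-unique : ∀ {x y} → x 0 ≡ 0ℝ → x 1 ≡ 1ℝ → y 0 ≡ 0ℝ → y 1 ≡ 1ℝ → x 2 ≡ y 2 →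
    CommutesWithφ x → CommutesWithφ y → x ≗ y
  commutesWithφ-unique {x} {y} x0≡0 x1≡1 y0≡0 y1≡1 x2≡y2 x-comm y-comm j =
    agree j j (ℕ.m≤n⇒m≤1+n (ℕ.n≤1+n j))
    where
      open ≡-Reasoning
      agree : ∀ n → AgreeUpTo (suc (suc n)) x y
      agree zero zero                      _ = trans x0≡0 (sym y0≡0)
      agree zero (suc zero)                _ = trans x1≡1 (sym y1≡1)
      agree zero (suc (suc zero))          _ = x2≡y2
      agree zero (suc (suc (suc _))) (s≤s (s≤s ()))
      agree (suc n) j j≤3+n with ℕ.m≤n⇒m<n∨m≡n j≤3+n
      ... | inj₁ (s≤s j≤2+n) = agree n j j≤2+n
      ... | inj₂ refl = *-cancelʳ-≢0 c (suc×1≢0 n) (+-cancelˡ (compLow x n) _ _ (begin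
          compLow x n + x (suc (suc (suc n))) * c   ≡⟨ commutesWithφ⇒recurrence x0≡0 x1≡1 x-comm n ⟩
          convLow x n                               ≡⟨ convLow-local n (agree n) ⟩
          convLow y n                               ≡⟨ sym (commutesWithφ⇒recurrence y0≡0 y1≡1 y-comm n) ⟩
          compLow y n + y (suc (suc (suc n))) * c   ≡⟨ cong (_+ y (suc (suc (suc n))) * c) (sym (compLow-local n (agree n))) ⟩
          compLow x n + y (suc (suc (suc n))) * c   ∎))
        where c = suc n ×ᵣ 1ℝ

  geomPair-commutesWithPascal : ∀ r → (geomPair r ⋆ pascal) ≈ₚ (pascal ⋆ geomPair r)
  geomPair-commutesWithPascal r = ≈ₚ-trans
    (subst (λ s → (geomPair r ⋆ pascal) ≈ₚ geomPair s) (+-comm 1ℝ r) (geomPair-⋆ 1ℝ r))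
    (≈ₚ-sym (geomPair-⋆ r 1ℝ))

  centralizer⇒geomPair : ∀ A → InCentralizer A → ∃ λ r → pair A ≈ₚ geomPair r
  centralizer⇒geomPair A ((e , _ , d≗e , h≗ze) , _ , h-comm) = r , d≗geom , h≗G
    where
      r = h A 2
      h1≡1 : h A 1 ≡ 1ℝ
      h1≡1 = commutesWithφ⇒coeff₁≡1 (proj₁ (h∈F₁ A)) (proj₂ (h∈F₁ A)) h-comm
      h≗G : h A ≗ zmul (geom r)
      h≗G = commutesWithφ-unique (proj₁ (h∈F₁ A)) h1≡1 refl refl (sym (*-identityʳ r))
        h-comm (proj₂ (geomPair-commutesWithPascal r))
      d≗geom : d A ≗ geom r
      d≗geom n = trans (d≗e n) (trans (sym (h≗ze (suc n))) (h≗G (suc n)))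

  geomPair⇒centralizer : ∀ A r → pair A ≈ₚ geomPair r → InCentralizer A
  geomPair⇒centralizer A r A≈ = (geom r , 1≢0 , A≈) , ≈ₚ-trans (⋆-cong A≈ ≈ₚ-refl)
    (≈ₚ-trans (geomPair-commutesWithPascal r) (⋆-cong ≈ₚ-refl (≈ₚ-sym A≈)))
    where
      ≈ₚ-refl : ∀ {p} → p ≈ₚ p
      ≈ₚ-refl = (λ _ → refl) , (λ _ → refl)

theorem2p5 : (ℝ : RealField) →
    let open RealField ℝ
        open Riordan ℝ
    in (A : RiordanArray) →
       (InCentralizer A → ∃ λ (r : Carrier) → pair A ≈ₚ geomPair r) ×
       ((∃ λ (r : Carrier) → pair A ≈ₚ geomPair r) → InCentralizer A)
theorem2p5 ℝ A = centralizer⇒geomPair A , λ (r , A≈) → geomPair⇒centralizer A r A≈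
  where open PascalCentralizer ℝ
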